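{- Let $K$ be a field, let $\mathcal R\subset\mathbb{Z}^k$ be a polyhedral region, and let $f$ be a hypergeometric term on $\mathcal R$ over $K$. Then the function $g\colon\mathbb{Z}^k\to K$ given by $g(\mathbf z)=f(\mathbf z)$ for $\mathbf z\in\mathcal R$ and $g(\mathbf z)=0$ for $\mathbf z\notin\mathcal R$ is a hypergeometric term on $\mathbb{Z}^k$.
   Context: $\mathbf e_i$ is the $i$-th unit vector. A half-space in $\mathbb{Z}^k$ is $\{\mathbf z:\mathbf v\cdot\mathbf z>n\}$, $\mathbf v\in\mathbb{Z}^k$, $n\in\mathbb{Z}$; a region is polyhedral if it equals $\mathbb{Z}^k$ or is a finite intersection of half-spaces. A hypergeometric term on $\mathbb{Z}^k$ over $K$ is a function $g\colon\mathbb{Z}^k\to K$ such that for each $i$ there are nonzero $A_i,B_i\in K[\mathbf z]$ with $A_i(\mathbf z)g(\mathbf z)=B_i(\mathbf z)g(\mathbf z+\mathbf e_i)$ for all $\mathbf z\in\mathbb{Z}^k$. A hypergeometric term on a polyhedral region $\mathcal R$ is a function $f\colon\mathcal R\to K$ such that for each $i$ there are nonzero $A_i,B_i\in K[\mathbf z]$ with $A_i(\mathbf z)f(\mathbf z)=B_i(\mathbf z)f(\mathbf z+\mathbf e_i)$ for all $\mathbf z$ with $\mathbf z\in\mathcal R$ and $\mathbf z+\mathbf e_i\in\mathcal R$. -}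

module Defs where

open import Level using (Level; _⊔_) renaming (suc to lsuc)
open import Algebra.Bundles using (CommutativeRing)
open import Data.Nat as ℕ using (ℕ; zero; suc)
open import Data.Integer as ℤ using (ℤ; +_; -[1+_])
open import Data.Fin using (Fin; zero; suc; _≟_)
open import Data.Vec using (Vec; []; _∷_; lookup)
open import Data.Vec.Properties using (≡-dec)
open import Data.List using (List; []; _∷_)
open import Data.List.Relation.Unary.All using (All)
open import Data.Product using (_×_; _,_; ∃; ∃₂)
open import Relation.Nullary using (¬_; does)
open import Data.Bool using (if_then_else_)

record Field (c ℓ : Level) : Set (lsuc (c ⊔ ℓ)) where
  field
    commutativeRing : CommutativeRing c ℓ
  open CommutativeRing commutativeRing public
  field
    0#≉1#   : ¬ (0# ≈ 1#)
    inverse : ∀ x → ¬ (x ≈ 0#) → ∃ λ y → x * y ≈ 1#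

ℤ^ : ℕ → Set
ℤ^ k = Fin k → ℤ

_+e_ : ∀ {k} → ℤ^ k → Fin k → ℤ^ k
(z +e i) j = if does (j ≟ i) then z j ℤ.+ ℤ.1ℤ else z j

dot : ∀ {k} → ℤ^ k → ℤ^ k → ℤ
dot {zero}  v z = ℤ.0ℤ
dot {suc k} v z = v zero ℤ.* z zero ℤ.+ dot (λ j → v (suc j)) (λ j → z (suc j))

HalfSpace : ℕ → Set
HalfSpace k = ℤ^ k × ℤ

_∈H_ : ∀ {k} → ℤ^ k → HalfSpace k → Set
z ∈H (v , n) = n ℤ.< dot v z

PolyhedralRegion : ℕ → Set
PolyhedralRegion k = List (HalfSpace k)

_∈R_ : ∀ {k} → ℤ^ k → PolyhedralRegion k → Set
z ∈R R = All (z ∈H_) R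

module _ {c ℓ} (K : Field c ℓ) where
  open Field K using (Carrier; _≈_; _+_; _*_; -_; 0#; 1#)

  -- sparse representation: a finite list of (coefficient, exponent vector)
  Poly : ℕ → Set c
  Poly k = List (Carrier × Vec ℕ k)

  coeff : ∀ {k} → Poly k → Vec ℕ k → Carrier
  coeff []             e = 0#
  coeff ((a , e') ∷ p) e = (if does (≡-dec ℕ._≟_ e' e) then a else 0#) + coeff p e

  NonZeroPoly : ∀ {k} → Poly k → Set ℓ
  NonZeroPoly {k} p = ∃ λ (e : Vec ℕ k) → ¬ (coeff p e ≈ 0#)

  fromℕ : ℕ → Carrier
  fromℕ zero    = 0#
  fromℕ (suc n) = 1# + fromℕ n

  fromℤ : ℤ → Carrier
  fromℤ (+ n)     = fromℕ n
  fromℤ -[1+ n ]  = - (fromℕ (suc n))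

  pow : Carrier → ℕ → Carrier
  pow x zero    = 1#
  pow x (suc n) = x * pow x n

  evalMono : ∀ {k} → Vec ℕ k → ℤ^ k → Carrier
  evalMono []      z = 1#
  evalMono (m ∷ e) z = pow (fromℤ (z zero)) m * evalMono e (λ j → z (suc j))

  eval : ∀ {k} → Poly k → ℤ^ k → Carrier
  eval []            z = 0#
  eval ((a , e) ∷ p) z = a * evalMono e z + eval p z

  IsHypergeometric : ∀ {k} → (ℤ^ k → Carrier) → Set (c ⊔ ℓ)
  IsHypergeometric {k} g =
    ∀ (i : Fin k) → ∃₂ λ (A B : Poly k) →
      NonZeroPoly A × NonZeroPoly B ×
      (∀ z → eval A z * g z ≈ eval B z * g (z +e i))

  IsHypergeometricOn : ∀ {k} → PolyhedralRegion k → (ℤ^ k → Carrier) → Set (c ⊔ ℓ)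
  IsHypergeometricOn {k} R f =
    ∀ (i : Fin k) → ∃₂ λ (A B : Poly k) →
      NonZeroPoly A × NonZeroPoly B ×
      (∀ z → z ∈R R → (z +e i) ∈R R → eval A z * f z ≈ eval B z * f (z +e i))

_∈H?_ : ∀ {k} (z : ℤ^ k) (h : HalfSpace k) → Data.Bool.Bool
z ∈H? (v , n) = does (n ℤ.<? dot v z)

_∈R?_ : ∀ {k} → ℤ^ k → PolyhedralRegion k → Data.Bool.Bool
z ∈R? []      = Data.Bool.true
z ∈R? (h ∷ R) = (z ∈H? h) Data.Bool.∧ (z ∈R? R)

extendByZero : ∀ {c ℓ} (K : Field c ℓ) {k} → PolyhedralRegion k → (ℤ^ k → Field.Carrier K) → ℤ^ k → Field.Carrier K
extendByZero K R f z = if z ∈R? R then f z else Field.0# K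

module Submission where

-- Fix a direction eᵢ. The recurrence A f(z) = B f(z + eᵢ) of f on R already holds for the
-- extension g by zero whenever z and z + eᵢ are both in R or both outside; the remaining
-- points z are those where the step z → z + eᵢ crosses the boundary of one of the defining
-- half-spaces v · z > n. Such z satisfy v · z = c for one of the finitely many c with
-- n - |vᵢ| < c ≤ n + |vᵢ|, so they lie on finitely many hyperplanes, each of which can be written as
-- u · z = c′ with u primitive (some integer combination of the uⱼ is 1). Multiplying A and B
-- by one polynomial W vanishing on all these hyperplanes gives a recurrence for g. The
-- delicate point is that AW and BW must stay nonzero over an arbitrary field K, with no
-- decidable equality and possibly positive characteristic: W is built so that it has a unit
-- coefficient at a monomial zᴹ dominating A and B, while its other monomials are too small in
-- some variable to interfere, so the coefficient of AW at zᵉ⁺ᴹ equals that of A at zᵉ.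

open import Level using (Level; _⊔_)
open import Data.Nat as ℕ using (ℕ; zero; suc)
import Data.Nat.Properties as ℕ
import Data.Nat.GCD as ℕ
open import Data.Integer as ℤ using (ℤ; +_; -[1+_])
import Data.Integer.Properties as ℤ
import Data.Integer.GCD as ℤ
open import Data.Sign as Sign using (Sign)
open import Data.Fin using (Fin; zero; suc; _≟_)
open import Data.Vec as Vec using (Vec; []; _∷_; lookup; zipWith; replicate; tabulate)
import Data.Vec.Properties as Vec
open import Data.List as List using (List; []; _∷_; _++_; concat; concatMap)
open import Data.List.Relation.Unary.All as All using (All; []; _∷_)
import Data.List.Relation.Unary.All.Properties as All
open import Data.List.Relation.Unary.Any as Any using (Any; here; there)
import Data.List.Relation.Unary.Any.Properties as Any
open import Data.List.Membership.Propositional using (_∈_)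
open import Data.Product using (_×_; _,_; ∃; ∃₂; proj₁; proj₂)
open import Data.Sum using (_⊎_; inj₁; inj₂; [_,_])
open import Data.Bool using (true; false; if_then_else_)
open import Data.Maybe using (Maybe; just; nothing)
open import Function using (_∘_)
open import Relation.Nullary using (¬_; does; yes; no; contradiction)
open import Relation.Nullary.Decidable using (dec-true; dec-false)
open import Relation.Binary.PropositionalEquality as ≡ using (_≡_; _≢_)
open import Data.Vec.Properties using (≡-dec)
import Algebra.Solver.Ring as RingSolver
open import Algebra.Solver.Ring.AlmostCommutativeRing
  using (AlmostCommutativeRing; fromCommutativeRing; _-Raw-AlmostCommutative⟶_)
open import Defs

module PrimitiveHyperplanes where
  open import Data.Integer
    using (0ℤ; 1ℤ; _+_; _-_; _*_; -_; _^_; ∣_∣; _<_; _≤_; NonZero; ≢-nonZero)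
  open import Data.Integer.Divisibility.Signed using (_∣_; divides; ∣ᵤ⇒∣; _∣?_)
  open import Data.Integer.Tactic.RingSolver using (solve-∀)
  open ℕ.Bézout using (+-; -+)
  open ≡ using (refl; sym; trans; cong; cong₂; subst)
  open ≡.≡-Reasoning

  dot-+e : ∀ {k} (v z : ℤ^ k) i → dot v (z +e i) ≡ dot v z + v i
  dot-+e {suc k} v z zero = shift (v zero) (z zero) (dot (λ j → v (suc j)) (λ j → z (suc j)))
    where
    shift : ∀ a b d → a * (b + 1ℤ) + d ≡ (a * b + d) + a
    shift = solve-∀
  dot-+e {suc k} v z (suc i) = trans
    (cong (_+_ (v zero * z zero)) (dot-+e (λ j → v (suc j)) (λ j → z (suc j)) i))
    (sym (ℤ.+-assoc (v zero * z zero) _ _))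

  dot-comm : ∀ {k} (v z : ℤ^ k) → dot v z ≡ dot z v
  dot-comm {zero} v z = refl
  dot-comm {suc k} v z = cong₂ _+_ (ℤ.*-comm (v zero) (z zero)) (dot-comm (λ j → v (suc j)) (λ j → z (suc j)))

  dot-scaleˡ : ∀ {k} s {v w : ℤ^ k} → (∀ j → v j ≡ s * w j) → ∀ z → dot v z ≡ s * dot w z
  dot-scaleˡ {zero} s _ z = sym (ℤ.*-zeroʳ s)
  dot-scaleˡ {suc k} s {v} {w} v≡sw z = begin
    v zero * z zero + dot (λ j → v (suc j)) z′
      ≡⟨ cong₂ _+_ (cong (_* z zero) (v≡sw zero)) (dot-scaleˡ s (λ j → v≡sw (suc j)) z′) ⟩
    s * w zero * z zero + s * dot w′ z′
      ≡⟨ cong (_+ s * dot w′ z′) (ℤ.*-assoc s (w zero) (z zero)) ⟩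
    s * (w zero * z zero) + s * dot w′ z′
      ≡⟨ ℤ.*-distribˡ-+ s _ _ ⟨
    s * (w zero * z zero + dot w′ z′) ∎
    where
    z′ = λ j → z (suc j)
    w′ = λ j → w (suc j)

  ∣i∣-as-multiple : ∀ i → ∃ λ s → + ∣ i ∣ ≡ s * i
  ∣i∣-as-multiple (+ m)    = 1ℤ , sym (ℤ.*-identityˡ (+ m))
  ∣i∣-as-multiple -[1+ m ] = ℤ.-1ℤ , sym (ℤ.-1*i≡-i -[1+ m ])

  bezout-from-ℕ : ∀ a b x y {d} → d ℕ.+ y ℕ.* ∣ b ∣ ≡ x ℕ.* ∣ a ∣ →
                  ∃₂ λ x′ y′ → x′ * a + y′ * b ≡ + d
  bezout-from-ℕ a b x y {d} eq =
    let sa , ∣a∣≡sa*a = ∣i∣-as-multiple a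
        sb , ∣b∣≡sb*b = ∣i∣-as-multiple b
        yb = + (y ℕ.* ∣ b ∣)
    in  + x * sa , - (+ y * sb) , (begin
      + x * sa * a + - (+ y * sb) * b    ≡⟨ regroup (+ x) sa a (+ y) sb b ⟩
      + x * (sa * a) - + y * (sb * b)    ≡⟨ cong₂ (λ p q → + x * p - + y * q) ∣a∣≡sa*a ∣b∣≡sb*b ⟨
      + x * + ∣ a ∣ - + y * + ∣ b ∣       ≡⟨ cong₂ _-_ (ℤ.pos-* x ∣ a ∣) (ℤ.pos-* y ∣ b ∣) ⟨
      + (x ℕ.* ∣ a ∣) - yb               ≡⟨ cong (λ p → + p - yb) eq ⟨
      + (d ℕ.+ y ℕ.* ∣ b ∣) - yb         ≡⟨ cong (_- yb) (ℤ.pos-+ d _) ⟩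
      + d + yb - yb                      ≡⟨ cancel (+ d) yb ⟩
      + d                                ∎)
    where
    regroup : ∀ x sa a y sb b → x * sa * a + - (y * sb) * b ≡ x * (sa * a) - y * (sb * b)
    regroup = solve-∀
    cancel : ∀ d p → d + p - p ≡ d
    cancel = solve-∀

  bezout : ∀ a b → ∃₂ λ x y → x * a + y * b ≡ ℤ.gcd a b
  bezout a b with ℕ.Bézout.identity (ℕ.gcd-GCD ∣ a ∣ ∣ b ∣)
  ... | +- x y eq = bezout-from-ℕ a b x y eq
  ... | -+ x y eq
    with x′ , y′ , e ← bezout-from-ℕ b a y x (subst (λ d → d ℕ.+ x ℕ.* ∣ a ∣ ≡ y ℕ.* ∣ b ∣) (ℕ.gcd-comm ∣ a ∣ ∣ b ∣) eq)
    = y′ , x′ , trans (ℤ.+-comm (y′ * a) (x′ * b)) (trans e (ℤ.gcd-comm b a))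

  record LinearGcd {k} (v : ℤ^ k) : Set where
    field
      gcd              : ℤ
      quotient         : ℤ^ k
      coefficients     : ℤ^ k
      v≡gcd*quotient   : ∀ j → v j ≡ gcd * quotient j
      dot-coefficients : dot coefficients v ≡ gcd

  linearGcd-suc : ∀ {k} (v : ℤ^ (suc k)) → LinearGcd (λ j → v (suc j)) → LinearGcd v
  linearGcd-suc v T = record
    { gcd              = g
    ; quotient         = λ { zero → _∣_.quotient g∣v₀ ; (suc j) → _∣_.quotient g∣d * T.quotient j }
    ; coefficients     = λ { zero → x ; (suc j) → y * T.coefficients j }
    ; v≡gcd*quotient   = λ { zero → trans (_∣_.equality g∣v₀) (ℤ.*-comm (_∣_.quotient g∣v₀) g)
                           ; (suc j) → trans (T.v≡gcd*quotient j)
                                        (trans (cong (_* T.quotient j) (_∣_.equality g∣d))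
                                             (regroup (_∣_.quotient g∣d) g (T.quotient j))) }
    ; dot-coefficients = trans (cong (_+_ (x * v zero))
                           (trans (dot-scaleˡ y (λ _ → refl) (λ j → v (suc j))) (cong (y *_) T.dot-coefficients)))
                           x*v₀+y*d≡g
    }
    where
    module T = LinearGcd T
    g = ℤ.gcd (v zero) T.gcd
    g∣v₀ : g ∣ v zero
    g∣v₀ = ∣ᵤ⇒∣ (ℤ.gcd[i,j]∣i (v zero) T.gcd)
    g∣d : g ∣ T.gcd
    g∣d = ∣ᵤ⇒∣ (ℤ.gcd[i,j]∣j (v zero) T.gcd)
    x y : ℤ
    x = proj₁ (bezout (v zero) T.gcd)
    y = proj₁ (proj₂ (bezout (v zero) T.gcd))
    x*v₀+y*d≡g : x * v zero + y * T.gcd ≡ g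
    x*v₀+y*d≡g = proj₂ (proj₂ (bezout (v zero) T.gcd))
    regroup : ∀ β g q → β * g * q ≡ g * (β * q)
    regroup = solve-∀

  linearGcd : ∀ {k} (v : ℤ^ k) → LinearGcd v
  linearGcd {zero} v = record
    { gcd = 0ℤ ; quotient = λ () ; coefficients = λ () ; v≡gcd*quotient = λ () ; dot-coefficients = refl }
  linearGcd {suc k} v = linearGcd-suc v (linearGcd (λ j → v (suc j)))

  ^-distrib-* : ∀ a b n → (a * b) ^ n ≡ a ^ n * b ^ n
  ^-distrib-* a b zero    = refl
  ^-distrib-* a b (suc n) = trans (cong ((a * b) *_) (^-distrib-* a b n)) (regroup a b (a ^ n) (b ^ n))
    where
    regroup : ∀ a b p q → a * b * (p * q) ≡ a * p * (b * q)
    regroup = solve-∀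

  geometricSum : ℤ → ℕ → ℤ
  geometricSum t zero    = 0ℤ
  geometricSum t (suc n) = 1ℤ + t * geometricSum t n

  geometricSum-telescopes : ∀ t n → t ^ n + geometricSum t n * (1ℤ - t) ≡ 1ℤ
  geometricSum-telescopes t zero    = refl
  geometricSum-telescopes t (suc n) = begin
    t * t ^ n + (1ℤ + t * s) * (1ℤ - t)  ≡⟨ regroup t (t ^ n) s ⟩
    t * (t ^ n + s * (1ℤ - t)) + (1ℤ - t) ≡⟨ cong (λ p → t * p + (1ℤ - t)) (geometricSum-telescopes t n) ⟩
    t * 1ℤ + (1ℤ - t)                     ≡⟨ cancel t ⟩
    1ℤ                                    ∎
    where
    s = geometricSum t n
    regroup : ∀ t p s → t * p + (1ℤ + t * s) * (1ℤ - t) ≡ t * (p + s * (1ℤ - t)) + (1ℤ - t)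
    regroup = solve-∀
    cancel : ∀ t → t * 1ℤ + (1ℤ - t) ≡ 1ℤ
    cancel = solve-∀

  -- The extra generator E makes the induction on k work: with t = μ₀ a₀ and
  -- s = 1 + t + … + tⁿ⁻¹ we have tⁿ + s (1 - t) = 1, and 1 - t = E + (μ₁a₁ + …), so
  -- (tⁿ + s E) together with a₁, …, a_{k-1} again generates 1; and tⁿ = μ₀ⁿ a₀ⁿ.
  bezout-powers′ : ∀ {k} n E (μ a : ℤ^ k) → E + dot μ a ≡ 1ℤ →
                   ∃₂ λ w (λ′ : ℤ^ k) → E * w + dot λ′ (λ j → a j ^ n) ≡ 1ℤ
  bezout-powers′ {zero} n E μ a E+0≡1 = 1ℤ , (λ ()) , trans (cong (_+ 0ℤ) (ℤ.*-identityʳ E)) E+0≡1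
  bezout-powers′ {suc k} n E μ a E+dot≡1 =
    extend (bezout-powers′ n (t ^ n + s * E) (λ j → s * μ (suc j)) (λ j → a (suc j)) tail-identity)
    where
    t = μ zero * a zero
    s = geometricSum t n
    R = dot (λ j → μ (suc j)) (λ j → a (suc j))
    tail-identity : t ^ n + s * E + dot (λ j → s * μ (suc j)) (λ j → a (suc j)) ≡ 1ℤ
    tail-identity = begin
      t ^ n + s * E + dot (λ j → s * μ (suc j)) (λ j → a (suc j))
        ≡⟨ cong (_+_ (t ^ n + s * E)) (dot-scaleˡ s {w = λ j → μ (suc j)} (λ _ → refl) (λ j → a (suc j))) ⟩
      t ^ n + s * E + s * R            ≡⟨ regroup′ t (t ^ n) s E R ⟩
      t ^ n + s * ((E + (t + R)) - t)  ≡⟨ cong (λ p → t ^ n + s * (p - t)) E+dot≡1 ⟩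
      t ^ n + s * (1ℤ - t)             ≡⟨ geometricSum-telescopes t n ⟩
      1ℤ                               ∎
      where
      regroup′ : ∀ t p s E R → p + s * E + s * R ≡ p + s * ((E + (t + R)) - t)
      regroup′ = solve-∀
    extend : (∃₂ λ w (λ′ : ℤ^ k) → (t ^ n + s * E) * w + dot λ′ (λ j → a (suc j) ^ n) ≡ 1ℤ) →
             ∃₂ λ w (λ′ : ℤ^ (suc k)) → E * w + dot λ′ (λ j → a j ^ n) ≡ 1ℤ
    extend (w , λ′ , eq) = s * w , (λ { zero → μ zero ^ n * w ; (suc j) → λ′ j }) , (begin
      E * (s * w) + (μ zero ^ n * w * a zero ^ n + S)     ≡⟨ regroup (μ zero ^ n) (a zero ^ n) E s w S ⟩
      (μ zero ^ n * a zero ^ n + s * E) * w + S           ≡⟨ cong (λ p → (p + s * E) * w + S) (^-distrib-* (μ zero) (a zero) n) ⟨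
      (t ^ n + s * E) * w + S                             ≡⟨ eq ⟩
      1ℤ                                                  ∎)
      where
      S = dot λ′ (λ j → a (suc j) ^ n)
      regroup : ∀ m x E s w S → E * (s * w) + (m * w * x + S) ≡ (m * x + s * E) * w + S
      regroup = solve-∀

  bezout-powers : ∀ {k} n (μ a : ℤ^ k) → dot μ a ≡ 1ℤ → ∃ λ (λ′ : ℤ^ k) → dot λ′ (λ j → a j ^ n) ≡ 1ℤ
  bezout-powers n μ a dot≡1 with w , λ′ , eq ← bezout-powers′ n 0ℤ μ a (trans (ℤ.+-identityˡ (dot μ a)) dot≡1)
    = λ′ , trans (sym (ℤ.+-identityˡ _)) (trans (cong (_+ dot λ′ (λ j → a j ^ n)) (sym (ℤ.*-zeroˡ w))) eq)

  record PrimitiveHyperplane (k : ℕ) : Set where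
    field
      normal       : ℤ^ k
      offset       : ℤ
      coefficients : ℤ^ k
      isPrimitive  : dot coefficients normal ≡ 1ℤ

  _∈ᴴ_ : ∀ {k} → ℤ^ k → PrimitiveHyperplane k → Set
  z ∈ᴴ h = dot (PrimitiveHyperplane.normal h) z ≡ PrimitiveHyperplane.offset h

  module _ {k} (v : ℤ^ k) {i : Fin k} (vᵢ≢0 : v i ≢ 0ℤ) where
    open LinearGcd (linearGcd v)

    private
      gcd≢0 : gcd ≢ 0ℤ
      gcd≢0 gcd≡0 = vᵢ≢0 (trans (v≡gcd*quotient i) (trans (cong (_* quotient i) gcd≡0) (ℤ.*-zeroˡ (quotient i))))

      instance
        gcd-nonZero : NonZero gcd
        gcd-nonZero = ≢-nonZero gcd≢0

      dot-v : ∀ z → dot v z ≡ gcd * dot quotient z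
      dot-v = dot-scaleˡ gcd v≡gcd*quotient

      quotient-isPrimitive : dot coefficients quotient ≡ 1ℤ
      quotient-isPrimitive = ℤ.*-cancelˡ-≡ gcd _ _ (begin
        gcd * dot coefficients quotient ≡⟨ cong (gcd *_) (dot-comm coefficients quotient) ⟩
        gcd * dot quotient coefficients ≡⟨ dot-v coefficients ⟨
        dot v coefficients              ≡⟨ dot-comm v coefficients ⟩
        dot coefficients v              ≡⟨ dot-coefficients ⟩
        gcd                             ≡⟨ ℤ.*-identityʳ gcd ⟨
        gcd * 1ℤ                        ∎)

      withOffset : ℤ → PrimitiveHyperplane k
      withOffset c = record
        { normal = quotient ; offset = c ; coefficients = coefficients ; isPrimitive = quotient-isPrimitive }

    -- When gcd ∤ c no integer point has v · z = c, so any offset will do.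
    primitiveHyperplane : (c : ℤ) → ∃ λ (h : PrimitiveHyperplane k) → ∀ z → dot v z ≡ c → z ∈ᴴ h
    primitiveHyperplane c with gcd ∣? c
    ... | yes (divides c′ c≡c′*gcd) = withOffset c′ , λ z v·z≡c →
          ℤ.*-cancelˡ-≡ gcd _ _ (trans (sym (dot-v z)) (trans v·z≡c (trans c≡c′*gcd (ℤ.*-comm c′ gcd))))
    ... | no gcd∤c = withOffset 0ℤ , λ z v·z≡c →
          contradiction (divides (dot quotient z) (trans (sym v·z≡c) (trans (dot-v z) (ℤ.*-comm gcd _)))) gcd∤c

  Crosses : ∀ {k} → Fin k → ℤ^ k → HalfSpace k → Set
  Crosses i z H = (z ∈H H × ¬ (z +e i) ∈H H) ⊎ (¬ z ∈H H × (z +e i) ∈H H)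

  parallel-never-crosses : ∀ {k} i (z : ℤ^ k) v n → v i ≡ 0ℤ → ¬ Crosses i z (v , n)
  parallel-never-crosses i z v n vᵢ≡0 =
    [ (λ (p , ¬q) → ¬q (subst (n <_) (sym unmoved) p)) , (λ (¬p , q) → ¬p (subst (n <_) unmoved q)) ]
    where
    unmoved : dot v (z +e i) ≡ dot v z
    unmoved = trans (dot-+e v z i) (trans (cong (_+_ (dot v z)) vᵢ≡0) (ℤ.+-identityʳ _))

  private
    i+j-j≡i : ∀ i j → i + j - j ≡ i
    i+j-j≡i = solve-∀

    i-m≤i : ∀ i m → i - + m ≤ i
    i-m≤i i m = subst (i - + m ≤_) (ℤ.+-identityʳ i) (ℤ.+-monoʳ-≤ i (ℤ.neg-mono-≤ (ℤ.+≤+ ℕ.z≤n)))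

    i≤i+m : ∀ i m → i ≤ i + + m
    i≤i+m i m = subst (_≤ i + + m) (ℤ.+-identityʳ i) (ℤ.+-monoʳ-≤ i (ℤ.+≤+ ℕ.z≤n))

    i≤∣i∣ : ∀ i → i ≤ + ∣ i ∣
    i≤∣i∣ (+ n)    = ℤ.≤-refl
    i≤∣i∣ -[1+ n ] = ℤ.-≤+

    -i≤∣i∣ : ∀ i → - i ≤ + ∣ i ∣
    -i≤∣i∣ i = subst (λ m → - i ≤ + m) (ℤ.∣-i∣≡∣i∣ i) (i≤∣i∣ (- i))

  crossing-bounds : ∀ {k} i (z : ℤ^ k) v n → Crosses i z (v , n) →
                    n - + ∣ v i ∣ < dot v z × dot v z ≤ n + + ∣ v i ∣
  crossing-bounds i z v n (inj₁ (n<x , n≮x+vᵢ)) =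
    ℤ.≤-<-trans (i-m≤i n ∣ v i ∣) n<x ,
    ℤ.≤-trans (subst (_≤ n - v i) (i+j-j≡i (dot v z) (v i))
                (ℤ.+-monoˡ-≤ (- v i) (subst (_≤ n) (dot-+e v z i) (ℤ.≮⇒≥ n≮x+vᵢ))))
              (ℤ.+-monoʳ-≤ n (-i≤∣i∣ (v i)))
  crossing-bounds i z v n (inj₂ (n≮x , n<x+vᵢ)) =
    ℤ.≤-<-trans (ℤ.+-monoʳ-≤ n (ℤ.neg-mono-≤ (i≤∣i∣ (v i))))
                (subst (n - v i <_) (i+j-j≡i (dot v z) (v i)) (ℤ.+-monoˡ-< (- v i) (subst (n <_) (dot-+e v z i) n<x+vᵢ))) ,
    ℤ.≤-trans (ℤ.≮⇒≥ n≮x) (i≤i+m n ∣ v i ∣)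

  interval : ℤ → ℕ → List ℤ
  interval a zero    = []
  interval a (suc r) = ℤ.suc a ∷ interval (ℤ.suc a) r

  ∈-interval : ∀ r {a x} → a < x → x ≤ a + + r → x ∈ interval a r
  ∈-interval zero    {a} a<x x≤a+0 = contradiction (subst (_ ≤_) (ℤ.+-identityʳ a) x≤a+0) (ℤ.<⇒≱ a<x)
  ∈-interval (suc r) {a} {x} a<x x≤a+1+r with x ℤ.≟ ℤ.suc a
  ... | yes x≡1+a = here x≡1+a
  ... | no  x≢1+a = there (∈-interval r (ℤ.≤∧≢⇒< (ℤ.i<j⇒suc[i]≤j a<x) (x≢1+a ∘ sym))
                                        (subst (x ≤_) (shift a r) x≤a+1+r))
    where
    shift : ∀ a r → a + + suc r ≡ ℤ.suc a + + r
    shift a r = trans (cong (_+_ a) (ℤ.pos-+ 1 r)) (regroup a (+ r))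
      where
      regroup : ∀ a r → a + (1ℤ + r) ≡ 1ℤ + a + r
      regroup = solve-∀

  crossingHyperplanes : ∀ {k} → Fin k → HalfSpace k → List (PrimitiveHyperplane k)
  crossingHyperplanes i (v , n) with v i ℤ.≟ 0ℤ
  ... | yes _   = []
  ... | no vᵢ≢0 = List.map (λ c → proj₁ (primitiveHyperplane v vᵢ≢0 c))
                           (interval (n - + ∣ v i ∣) (∣ v i ∣ ℕ.+ ∣ v i ∣))

  crosses⇒on-crossingHyperplane : ∀ {k} i (z : ℤ^ k) H → Crosses i z H → Any (z ∈ᴴ_) (crossingHyperplanes i H)
  crosses⇒on-crossingHyperplane i z (v , n) crosses with v i ℤ.≟ 0ℤ
  ... | yes vᵢ≡0 = contradiction crosses (parallel-never-crosses i z v n vᵢ≡0)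
  ... | no  vᵢ≢0 = Any.map⁺ (Any.map (λ {c} → proj₂ (primitiveHyperplane v vᵢ≢0 c) z)
                    (∈-interval (∣ v i ∣ ℕ.+ ∣ v i ∣) (proj₁ bounds) (subst (dot v z ≤_) top (proj₂ bounds))))
    where
    bounds = crossing-bounds i z v n crosses
    top : n + + ∣ v i ∣ ≡ n - + ∣ v i ∣ + + (∣ v i ∣ ℕ.+ ∣ v i ∣)
    top = trans (regroup n (+ ∣ v i ∣)) (cong (_+_ (n - + ∣ v i ∣)) (sym (ℤ.pos-+ ∣ v i ∣ ∣ v i ∣)))
      where
      regroup : ∀ n m → n + m ≡ n - m + (m + m)
      regroup = solve-∀

  boundaryHyperplanes : ∀ {k} → Fin k → PolyhedralRegion k → List (PrimitiveHyperplane k)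
  boundaryHyperplanes i = concatMap (crossingHyperplanes i)

  crosses⇒on-boundaryHyperplane : ∀ {k} i (z : ℤ^ k) R → Any (Crosses i z) R →
                                  Any (z ∈ᴴ_) (boundaryHyperplanes i R)
  crosses⇒on-boundaryHyperplane i z R crosses =
    Any.concat⁺ (Any.map⁺ (Any.map (crosses⇒on-crossingHyperplane i z _) crosses))

  ∈R?⇒∈R : ∀ {k} (z : ℤ^ k) R → (z ∈R? R) ≡ true → z ∈R R
  ∈R?⇒∈R z []            _   = []
  ∈R?⇒∈R z ((v , n) ∷ R) in? with n ℤ.<? dot v z
  ... | yes n<x = n<x ∷ ∈R?⇒∈R z R in?
  ... | no  _   = contradiction in? λ ()

  exit⇒crosses : ∀ {k} i (z : ℤ^ k) R → (z ∈R? R) ≡ true → ((z +e i) ∈R? R) ≡ false → Any (Crosses i z) R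
  exit⇒crosses i z ((v , n) ∷ R) in? out? with n ℤ.<? dot v z | n ℤ.<? dot v (z +e i)
  ... | yes n<x | no n≮x′ = here (inj₁ (n<x , n≮x′))
  ... | yes _   | yes _   = there (exit⇒crosses i z R in? out?)
  ... | no _    | _       = contradiction in? λ ()

  entry⇒crosses : ∀ {k} i (z : ℤ^ k) R → (z ∈R? R) ≡ false → ((z +e i) ∈R? R) ≡ true → Any (Crosses i z) R
  entry⇒crosses i z ((v , n) ∷ R) out? in? with n ℤ.<? dot v z | n ℤ.<? dot v (z +e i)
  ... | no n≮x | yes n<x′ = here (inj₂ (n≮x , n<x′))
  ... | yes _  | yes _    = there (entry⇒crosses i z R out? in?)
  ... | _      | no _     = contradiction in? λ ()

open PrimitiveHyperplanes

infixl 6 _⊕_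
_⊕_ : ∀ {k} → Vec ℕ k → Vec ℕ k → Vec ℕ k
_⊕_ = zipWith ℕ._+_

unitExponent : ∀ {k} → Fin k → ℕ → Vec ℕ k
unitExponent j a = tabulate (λ t → if does (t ≟ j) then a else 0)

⊕-cancelʳ : ∀ {k} (e′ e M : Vec ℕ k) → e′ ⊕ M ≡ e ⊕ M → e′ ≡ e
⊕-cancelʳ []       []      []      _  = ≡.refl
⊕-cancelʳ (a ∷ e′) (b ∷ e) (m ∷ M) eq =
  ≡.cong₂ _∷_ (ℕ.+-cancelʳ-≡ m a b (≡.cong Vec.head eq)) (⊕-cancelʳ e′ e M (≡.cong Vec.tail eq))

⊕-far : ∀ {k} N (e′ d e M : Vec ℕ k) j → lookup e′ j ℕ.< N → lookup d j ℕ.+ N ℕ.≤ lookup M j → e′ ⊕ d ≢ e ⊕ M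
⊕-far N e′ d e M j e′<N d+N≤M eq = ℕ.<⇒≱ e′<N (ℕ.+-cancelʳ-≤ (lookup d j) N (lookup e′ j) (begin
  N ℕ.+ lookup d j           ≡⟨ ℕ.+-comm N (lookup d j) ⟩
  lookup d j ℕ.+ N           ≤⟨ d+N≤M ⟩
  lookup M j                 ≤⟨ ℕ.m≤n+m _ (lookup e j) ⟩
  lookup e j ℕ.+ lookup M j  ≡⟨ Vec.lookup-zipWith ℕ._+_ j e M ⟨
  lookup (e ⊕ M) j           ≡⟨ ≡.cong (λ v → lookup v j) eq ⟨
  lookup (e′ ⊕ d) j          ≡⟨ Vec.lookup-zipWith ℕ._+_ j e′ d ⟩
  lookup e′ j ℕ.+ lookup d j ∎))
  where open ℕ.≤-Reasoning

Vec-ext : ∀ {k} {xs ys : Vec ℕ k} → (∀ t → lookup xs t ≡ lookup ys t) → xs ≡ ys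
Vec-ext {xs = xs} {ys} pointwise =
  ≡.trans (≡.sym (Vec.tabulate∘lookup xs)) (≡.trans (Vec.tabulate-cong pointwise) (Vec.tabulate∘lookup ys))

exponentExcept : ∀ {k} → Fin k → ℕ → Vec ℕ k
exponentExcept j a = tabulate (λ t → if does (t ≟ j) then 0 else a)

lookup-exponentExcept : ∀ {k} (j : Fin k) a → lookup (exponentExcept j a) j ≡ 0
lookup-exponentExcept j a = ≡.trans (Vec.lookup∘tabulate _ j) (≡.cong (λ b → if b then 0 else a) (dec-true (j ≟ j) ≡.refl))

replicate≡exponentExcept⊕unit : ∀ {k} n (j : Fin k) → replicate k n ≡ exponentExcept j n ⊕ unitExponent j n
replicate≡exponentExcept⊕unit n j = Vec-ext λ t → ≡.trans (Vec.lookup-replicate t n) (≡.sym (begin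
  lookup (exponentExcept j n ⊕ unitExponent j n) t
    ≡⟨ Vec.lookup-zipWith ℕ._+_ t (exponentExcept j n) (unitExponent j n) ⟩
  lookup (exponentExcept j n) t ℕ.+ lookup (unitExponent j n) t
    ≡⟨ ≡.cong₂ ℕ._+_ (Vec.lookup∘tabulate _ t) (Vec.lookup∘tabulate _ t) ⟩
  (if does (t ≟ j) then 0 else n) ℕ.+ (if does (t ≟ j) then n else 0)
    ≡⟨ complementary (does (t ≟ j)) ⟩
  n ∎))
  where
  open ≡.≡-Reasoning
  complementary : ∀ b → (if b then 0 else n) ℕ.+ (if b then n else 0) ≡ n
  complementary true  = ≡.refl
  complementary false = ℕ.+-identityʳ n

maxEntry : ∀ {k} → Vec ℕ k → ℕ
maxEntry []      = 0
maxEntry (x ∷ v) = x ℕ.⊔ maxEntry v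

lookup≤maxEntry : ∀ {k} (v : Vec ℕ k) j → lookup v j ℕ.≤ maxEntry v
lookup≤maxEntry (x ∷ v) zero    = ℕ.m≤m⊔n x (maxEntry v)
lookup≤maxEntry (x ∷ v) (suc j) = ℕ.≤-trans (lookup≤maxEntry v j) (ℕ.m≤n⊔m x (maxEntry v))

module _ {c ℓ} (K : Field c ℓ) where
  open Field K hiding (zero)
  open import Algebra.Properties.Ring ring using (-1*x≈-x; -0#≈0#; -‿involutive; -‿distribˡ-*)
  open import Algebra.Properties.AbelianGroup +-abelianGroup using (⁻¹-∙-comm)
  open import Algebra.Properties.CommutativeSemigroup +-commutativeSemigroup using () renaming (interchange to +-interchange)
  open import Algebra.Properties.CommutativeSemigroup *-commutativeSemigroup using () renaming (interchange to *-interchange)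
  open import Algebra.Properties.Monoid.Mult +-monoid using (×-homo-+) renaming (_×_ to _×ᴷ_)
  open import Algebra.Properties.Semiring.Mult semiring using (×1-homo-*)
  open import Algebra.Properties.CommutativeMonoid.Sum +-commutativeMonoid using (sum; sum-cong-≋; ∑-distrib-+; sum-replicate-zero)
  open import Relation.Binary.Reasoning.Setoid setoid

  -‿distrib-+ : ∀ x y → - (x + y) ≈ - x + - y
  -‿distrib-+ x y = sym (⁻¹-∙-comm x y)

  fromℕ≈× : ∀ n → fromℕ K n ≈ n ×ᴷ 1#
  fromℕ≈× zero    = refl
  fromℕ≈× (suc n) = +-congˡ (fromℕ≈× n)

  fromℕ-+ : ∀ m n → fromℕ K (m ℕ.+ n) ≈ fromℕ K m + fromℕ K n
  fromℕ-+ m n = trans (fromℕ≈× (m ℕ.+ n)) (trans (×-homo-+ 1# m n) (sym (+-cong (fromℕ≈× m) (fromℕ≈× n))))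

  fromℕ-* : ∀ m n → fromℕ K (m ℕ.* n) ≈ fromℕ K m * fromℕ K n
  fromℕ-* m n = trans (fromℕ≈× (m ℕ.* n)) (trans (×1-homo-* m n) (sym (*-cong (fromℕ≈× m) (fromℕ≈× n))))

  +-cancel-common : ∀ x a b → (x + a) - (x + b) ≈ a - b
  +-cancel-common x a b = begin
    (x + a) + - (x + b)  ≈⟨ +-congˡ (-‿distrib-+ x b) ⟩
    (x + a) + (- x + - b) ≈⟨ +-interchange x a (- x) (- b) ⟩
    (x - x) + (a - b)    ≈⟨ +-congʳ (-‿inverseʳ x) ⟩
    0# + (a - b)         ≈⟨ +-identityˡ _ ⟩
    a - b                ∎

  fromℤ-⊖ : ∀ m n → fromℤ K (m ℤ.⊖ n) ≈ fromℕ K m - fromℕ K n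
  fromℤ-⊖ m       zero    = sym (trans (+-congˡ -0#≈0#) (+-identityʳ _))
  fromℤ-⊖ zero    (suc n) = sym (+-identityˡ _)
  fromℤ-⊖ (suc m) (suc n) = begin
    fromℤ K (suc m ℤ.⊖ suc n)    ≡⟨ ≡.cong (fromℤ K) (ℤ.[1+m]⊖[1+n]≡m⊖n m n) ⟩
    fromℤ K (m ℤ.⊖ n)            ≈⟨ fromℤ-⊖ m n ⟩
    fromℕ K m - fromℕ K n        ≈⟨ +-cancel-common 1# (fromℕ K m) (fromℕ K n) ⟨
    fromℕ K (suc m) - fromℕ K (suc n) ∎

  fromℤ-+ : ∀ i j → fromℤ K (i ℤ.+ j) ≈ fromℤ K i + fromℤ K j
  fromℤ-+ (+ m)    (+ n)    = fromℕ-+ m n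
  fromℤ-+ (+ m)    -[1+ n ] = fromℤ-⊖ m (suc n)
  fromℤ-+ -[1+ m ] (+ n)    = trans (fromℤ-⊖ n (suc m)) (+-comm _ _)
  fromℤ-+ -[1+ m ] -[1+ n ] = begin
    - fromℕ K (suc (suc (m ℕ.+ n)))          ≡⟨ ≡.cong (λ p → - fromℕ K (suc p)) (ℕ.+-suc m n) ⟨
    - fromℕ K (suc m ℕ.+ suc n)              ≈⟨ -‿cong (fromℕ-+ (suc m) (suc n)) ⟩
    - (fromℕ K (suc m) + fromℕ K (suc n))    ≈⟨ -‿distrib-+ _ _ ⟩
    - fromℕ K (suc m) + - fromℕ K (suc n)    ∎

  fromℤ-neg : ∀ i → fromℤ K (ℤ.- i) ≈ - fromℤ K i
  fromℤ-neg (+ zero)  = sym -0#≈0#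
  fromℤ-neg (+ suc n) = refl
  fromℤ-neg -[1+ n ]  = sym (-‿involutive _)

  signValue : Sign → Carrier
  signValue Sign.+ = 1#
  signValue Sign.- = - 1#

  signValue-* : ∀ s t → signValue (s Sign.* t) ≈ signValue s * signValue t
  signValue-* Sign.+ t      = sym (*-identityˡ _)
  signValue-* Sign.- Sign.+ = sym (*-identityʳ _)
  signValue-* Sign.- Sign.- = sym (trans (-1*x≈-x (- 1#)) (-‿involutive 1#))

  fromℤ-◃ : ∀ s n → fromℤ K (s ℤ.◃ n) ≈ signValue s * fromℕ K n
  fromℤ-◃ Sign.+ zero    = sym (*-identityˡ _)
  fromℤ-◃ Sign.+ (suc n) = sym (*-identityˡ _)
  fromℤ-◃ Sign.- zero    = sym (zeroʳ _)
  fromℤ-◃ Sign.- (suc n) = sym (-1*x≈-x _)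

  fromℤ≈sign*abs : ∀ i → fromℤ K i ≈ signValue (ℤ.sign i) * fromℕ K ℤ.∣ i ∣
  fromℤ≈sign*abs i = trans (reflexive (≡.cong (fromℤ K) (≡.sym (ℤ.◃-inverse i)))) (fromℤ-◃ (ℤ.sign i) ℤ.∣ i ∣)

  fromℤ-* : ∀ i j → fromℤ K (i ℤ.* j) ≈ fromℤ K i * fromℤ K j
  fromℤ-* i j = begin
    fromℤ K (i ℤ.* j)
      ≈⟨ fromℤ-◃ (s Sign.* t) (ℤ.∣ i ∣ ℕ.* ℤ.∣ j ∣) ⟩
    signValue (s Sign.* t) * fromℕ K (ℤ.∣ i ∣ ℕ.* ℤ.∣ j ∣)
      ≈⟨ *-cong (signValue-* s t) (fromℕ-* ℤ.∣ i ∣ ℤ.∣ j ∣) ⟩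
    (signValue s * signValue t) * (fromℕ K ℤ.∣ i ∣ * fromℕ K ℤ.∣ j ∣)
      ≈⟨ *-interchange _ _ _ _ ⟩
    (signValue s * fromℕ K ℤ.∣ i ∣) * (signValue t * fromℕ K ℤ.∣ j ∣)
      ≈⟨ *-cong (fromℤ≈sign*abs i) (fromℤ≈sign*abs j) ⟨
    fromℤ K i * fromℤ K j ∎
    where
    s = ℤ.sign i
    t = ℤ.sign j

  private
    K-almostCommutativeRing : AlmostCommutativeRing c ℓ
    K-almostCommutativeRing = fromCommutativeRing commutativeRing

    fromℤ-morphism : ℤ.+-*-rawRing -Raw-AlmostCommutative⟶ K-almostCommutativeRing
    fromℤ-morphism = record
      { ⟦_⟧ = fromℤ K ; +-homo = fromℤ-+ ; *-homo = fromℤ-* ; -‿homo = fromℤ-neg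
      ; 0-homo = refl ; 1-homo = +-identityʳ 1# }

    fromℤ-≈? : ∀ i j → Maybe (fromℤ K i ≈ fromℤ K j)
    fromℤ-≈? i j with i ℤ.≟ j
    ... | yes ≡.refl = just refl
    ... | no  _      = nothing

  open RingSolver ℤ.+-*-rawRing K-almostCommutativeRing fromℤ-morphism fromℤ-≈?
    using (solve; _:+_; _:*_; :-_; _:=_; con)

  pow-+ : ∀ x m n → pow K x (m ℕ.+ n) ≈ pow K x m * pow K x n
  pow-+ x zero    n = sym (*-identityˡ _)
  pow-+ x (suc m) n = trans (*-congˡ (pow-+ x m n)) (sym (*-assoc _ _ _))

  pow-* : ∀ x y n → pow K (x * y) n ≈ pow K x n * pow K y n
  pow-* x y zero    = sym (*-identityˡ _)
  pow-* x y (suc n) = trans (*-congˡ (pow-* x y n)) (*-interchange x y (pow K x n) (pow K y n))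

  pow-cong : ∀ {x y} n → x ≈ y → pow K x n ≈ pow K y n
  pow-cong zero    _   = refl
  pow-cong (suc n) x≈y = *-cong x≈y (pow-cong n x≈y)

  fromℤ-^ : ∀ a n → fromℤ K (a ℤ.^ n) ≈ pow K (fromℤ K a) n
  fromℤ-^ a zero    = +-identityʳ 1#
  fromℤ-^ a (suc n) = trans (fromℤ-* a (a ℤ.^ n)) (*-congˡ (fromℤ-^ a n))

  fromℤ-dot : ∀ {k} (v z : ℤ^ k) → fromℤ K (dot v z) ≈ sum (λ j → fromℤ K (v j) * fromℤ K (z j))
  fromℤ-dot {zero}  v z = refl
  fromℤ-dot {suc k} v z = trans (fromℤ-+ (v zero ℤ.* z zero) _)
    (+-cong (fromℤ-* (v zero) (z zero)) (fromℤ-dot (λ j → v (suc j)) (λ j → z (suc j))))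

  sum-zero : ∀ {k} (f : Fin k → Carrier) → (∀ j → f j ≈ 0#) → sum f ≈ 0#
  sum-zero {k} f f≈0 = trans (sum-cong-≋ f≈0) (sum-replicate-zero k)

  sum-neg : ∀ {k} (f : Fin k → Carrier) → sum (λ j → - f j) ≈ - sum f
  sum-neg {zero}  f = sym -0#≈0#
  sum-neg {suc k} f = trans (+-congˡ (sum-neg (λ j → f (suc j)))) (sym (-‿distrib-+ _ _))

  sum-except : ∀ {k} (j : Fin k) (g : Fin k → Carrier) →
               sum (λ t → if does (t ≟ j) then 0# else g t) ≈ sum g - g j
  sum-except {suc k} zero g = begin
    0# + sum (λ t → g (suc t))           ≈⟨ solve 2 (λ a s → con ℤ.0ℤ :+ s := (a :+ s) :+ :- a) refl (g zero) _ ⟩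
    (g zero + sum (λ t → g (suc t))) - g zero ∎
  sum-except {suc k} (suc j) g = trans (+-congˡ (sum-except j (λ t → g (suc t)))) (sym (+-assoc _ _ _))

  mulMonomial : ∀ {k} → Carrier → Vec ℕ k → Poly K k → Poly K k
  mulMonomial a e []            = []
  mulMonomial a e ((b , d) ∷ q) = (a * b , e ⊕ d) ∷ mulMonomial a e q

  infixl 7 _*ᴾ_
  _*ᴾ_ : ∀ {k} → Poly K k → Poly K k → Poly K k
  []            *ᴾ q = []
  ((a , e) ∷ p) *ᴾ q = mulMonomial a e q ++ p *ᴾ q

  oneᴾ : ∀ {k} → Poly K k
  oneᴾ = (1# , tabulate (λ _ → 0)) ∷ []

  infixr 8 _^ᴾ_
  _^ᴾ_ : ∀ {k} → Poly K k → ℕ → Poly K k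
  p ^ᴾ zero  = oneᴾ
  p ^ᴾ suc n = p *ᴾ p ^ᴾ n

  eval-++ : ∀ {k} (p q : Poly K k) z → eval K (p ++ q) z ≈ eval K p z + eval K q z
  eval-++ []            q z = sym (+-identityˡ _)
  eval-++ ((a , e) ∷ p) q z = trans (+-congˡ (eval-++ p q z)) (sym (+-assoc _ _ _))

  evalMono-⊕ : ∀ {k} (e d : Vec ℕ k) z → evalMono K (e ⊕ d) z ≈ evalMono K e z * evalMono K d z
  evalMono-⊕ []      []      z = sym (*-identityˡ _)
  evalMono-⊕ (m ∷ e) (n ∷ d) z = begin
    pow K x (m ℕ.+ n) * evalMono K (e ⊕ d) z′                    ≈⟨ *-cong (pow-+ x m n) (evalMono-⊕ e d z′) ⟩
    (pow K x m * pow K x n) * (evalMono K e z′ * evalMono K d z′) ≈⟨ *-interchange _ _ _ _ ⟩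
    (pow K x m * evalMono K e z′) * (pow K x n * evalMono K d z′) ∎
    where
    x = fromℤ K (z zero)
    z′ = λ j → z (suc j)

  evalMono-zeros : ∀ {k} (f : Fin k → ℕ) → (∀ t → f t ≡ 0) → ∀ z → evalMono K (tabulate f) z ≈ 1#
  evalMono-zeros {zero}  f f≡0 z = refl
  evalMono-zeros {suc k} f f≡0 z rewrite f≡0 zero =
    trans (*-identityˡ _) (evalMono-zeros (λ t → f (suc t)) (λ t → f≡0 (suc t)) (λ j → z (suc j)))

  evalMono-unit : ∀ {k} (j : Fin k) a z → evalMono K (unitExponent j a) z ≈ pow K (fromℤ K (z j)) a
  evalMono-unit {suc k} zero    a z = trans (*-congˡ (evalMono-zeros _ (λ _ → ≡.refl) (λ j → z (suc j)))) (*-identityʳ _)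
  evalMono-unit {suc k} (suc j) a z = trans (*-identityˡ _) (evalMono-unit j a (λ t → z (suc t)))

  eval-mulMonomial : ∀ {k} a (e : Vec ℕ k) q z → eval K (mulMonomial a e q) z ≈ a * evalMono K e z * eval K q z
  eval-mulMonomial a e []            z = sym (zeroʳ _)
  eval-mulMonomial a e ((b , d) ∷ q) z = begin
    a * b * evalMono K (e ⊕ d) z + eval K (mulMonomial a e q) z
      ≈⟨ +-cong (*-congˡ (evalMono-⊕ e d z)) (eval-mulMonomial a e q z) ⟩
    a * b * (evalMono K e z * evalMono K d z) + a * evalMono K e z * eval K q z
      ≈⟨ solve 5 (λ a b x y r → a :* b :* (x :* y) :+ a :* x :* r := a :* x :* (b :* y :+ r)) refl
               a b (evalMono K e z) (evalMono K d z) (eval K q z) ⟩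
    a * evalMono K e z * (b * evalMono K d z + eval K q z) ∎

  eval-*ᴾ : ∀ {k} (p q : Poly K k) z → eval K (p *ᴾ q) z ≈ eval K p z * eval K q z
  eval-*ᴾ []            q z = sym (zeroˡ _)
  eval-*ᴾ ((a , e) ∷ p) q z = begin
    eval K (mulMonomial a e q ++ p *ᴾ q) z                  ≈⟨ eval-++ (mulMonomial a e q) (p *ᴾ q) z ⟩
    eval K (mulMonomial a e q) z + eval K (p *ᴾ q) z        ≈⟨ +-cong (eval-mulMonomial a e q z) (eval-*ᴾ p q z) ⟩
    a * evalMono K e z * eval K q z + eval K p z * eval K q z ≈⟨ distribʳ _ _ _ ⟨
    (a * evalMono K e z + eval K p z) * eval K q z          ∎

  eval-^ᴾ : ∀ {k} (p : Poly K k) n z → eval K (p ^ᴾ n) z ≈ pow K (eval K p z) n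
  eval-^ᴾ p zero    z = trans (+-identityʳ _) (trans (*-congˡ (evalMono-zeros _ (λ _ → ≡.refl) z)) (*-identityʳ _))
  eval-^ᴾ p (suc n) z = trans (eval-*ᴾ p (p ^ᴾ n) z) (*-congˡ (eval-^ᴾ p n z))

  eval-tabulate : ∀ {k m} (f : Fin m → Carrier × Vec ℕ k) z →
                  eval K (List.tabulate f) z ≈ sum (λ j → proj₁ (f j) * evalMono K (proj₂ (f j)) z)
  eval-tabulate {m = zero}  f z = refl
  eval-tabulate {m = suc m} f z = +-congˡ (eval-tabulate (λ j → f (suc j)) z)

  eval-concat-tabulate : ∀ {k m} (f : Fin m → Poly K k) z →
                         eval K (concat (List.tabulate f)) z ≈ sum (λ j → eval K (f j) z)
  eval-concat-tabulate {m = zero}  f z = refl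
  eval-concat-tabulate {m = suc m} f z =
    trans (eval-++ (f zero) _ z) (+-congˡ (eval-concat-tabulate (λ j → f (suc j)) z))

  termCoeff : ∀ {k} → Vec ℕ k → Vec ℕ k → Carrier → Carrier
  termCoeff e′ e a = if does (≡-dec ℕ._≟_ e′ e) then a else 0#

  termCoeff-refl : ∀ {k} (e : Vec ℕ k) a → termCoeff e e a ≈ a
  termCoeff-refl e a with ≡-dec ℕ._≟_ e e
  ... | yes _   = refl
  ... | no e≢e = contradiction ≡.refl e≢e

  termCoeff-≢ : ∀ {k} (e′ e : Vec ℕ k) a → e′ ≢ e → termCoeff e′ e a ≈ 0#
  termCoeff-≢ e′ e a e′≢e with ≡-dec ℕ._≟_ e′ e
  ... | yes e′≡e = contradiction e′≡e e′≢e
  ... | no _     = refl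

  termCoeff-0 : ∀ {k} (e′ e : Vec ℕ k) a → a ≈ 0# → termCoeff e′ e a ≈ 0#
  termCoeff-0 e′ e a a≈0 with ≡-dec ℕ._≟_ e′ e
  ... | yes _ = a≈0
  ... | no _  = refl

  coeff-++ : ∀ {k} (p q : Poly K k) e → coeff K (p ++ q) e ≈ coeff K p e + coeff K q e
  coeff-++ []             q e = sym (+-identityˡ _)
  coeff-++ ((a , e′) ∷ p) q e = trans (+-congˡ (coeff-++ p q e)) (sym (+-assoc _ _ _))

  mulMonomial-++ : ∀ {k} a (e : Vec ℕ k) p q → mulMonomial a e (p ++ q) ≡ mulMonomial a e p ++ mulMonomial a e q
  mulMonomial-++ a e []      q = ≡.refl
  mulMonomial-++ a e (t ∷ p) q = ≡.cong (_ ∷_) (mulMonomial-++ a e p q)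

  ExponentsBelow : ∀ {k} → ℕ → Poly K k → Set c
  ExponentsBelow N = All (λ (_ , e) → ∀ j → lookup e j ℕ.< N)

  ExponentsEqual : ∀ {k} → Vec ℕ k → Poly K k → Set c
  ExponentsEqual M = All (λ (_ , e) → e ≡ M)

  FarTerm : ∀ {k} → ℕ → Vec ℕ k → Carrier × Vec ℕ k → Set ℓ
  FarTerm N M (a , e) = a ≈ 0# ⊎ ∃ λ j → lookup e j ℕ.+ N ℕ.≤ lookup M j

  FarBelow : ∀ {k} → ℕ → Vec ℕ k → Poly K k → Set (c ⊔ ℓ)
  FarBelow N M = All (FarTerm N M)

  coeff-mulMonomial-aligned : ∀ {k} a (e′ e M : Vec ℕ k) T → ExponentsEqual M T →
                              coeff K (mulMonomial a e′ T) (e ⊕ M) ≈ termCoeff e′ e a * coeff K T M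
  coeff-mulMonomial-aligned a e′ e M []            []            = sym (zeroʳ _)
  coeff-mulMonomial-aligned a e′ e M ((t , .M) ∷ T) (≡.refl ∷ eqs) = begin
    termCoeff (e′ ⊕ M) (e ⊕ M) (a * t) + coeff K (mulMonomial a e′ T) (e ⊕ M)
      ≈⟨ +-cong aligned (coeff-mulMonomial-aligned a e′ e M T eqs) ⟩
    termCoeff e′ e a * t + termCoeff e′ e a * coeff K T M
      ≈⟨ +-congʳ (*-congˡ (termCoeff-refl M t)) ⟨
    termCoeff e′ e a * termCoeff M M t + termCoeff e′ e a * coeff K T M
      ≈⟨ distribˡ _ _ _ ⟨
    termCoeff e′ e a * (termCoeff M M t + coeff K T M) ∎
    where
    aligned : termCoeff (e′ ⊕ M) (e ⊕ M) (a * t) ≈ termCoeff e′ e a * t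
    aligned with ≡-dec ℕ._≟_ e′ e
    ... | yes ≡.refl = termCoeff-refl (e′ ⊕ M) (a * t)
    ... | no e′≢e    = trans (termCoeff-≢ (e′ ⊕ M) (e ⊕ M) (a * t) (e′≢e ∘ ⊕-cancelʳ e′ e M)) (sym (zeroˡ t))

  coeff-mulMonomial-far : ∀ {k} N a (e′ e M : Vec ℕ k) F → (∀ j → lookup e′ j ℕ.< N) → FarBelow N M F →
                          coeff K (mulMonomial a e′ F) (e ⊕ M) ≈ 0#
  coeff-mulMonomial-far N a e′ e M []             e′<N []            = refl
  coeff-mulMonomial-far N a e′ e M ((b , d) ∷ F) e′<N (far ∷ fars) =
    trans (+-cong (vanishing far) (coeff-mulMonomial-far N a e′ e M F e′<N fars)) (+-identityˡ 0#)
    where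
    vanishing : FarTerm N M (b , d) → termCoeff (e′ ⊕ d) (e ⊕ M) (a * b) ≈ 0#
    vanishing (inj₁ b≈0)           = termCoeff-0 (e′ ⊕ d) (e ⊕ M) (a * b) (trans (*-congˡ b≈0) (zeroʳ a))
    vanishing (inj₂ (j , d+N≤M)) = termCoeff-≢ (e′ ⊕ d) (e ⊕ M) (a * b) (⊕-far N e′ d e M j (e′<N j) d+N≤M)

  coeff-*ᴾ-leading : ∀ {k} N (M : Vec ℕ k) T F A e → ExponentsBelow N A → ExponentsEqual M T → FarBelow N M F →
                     coeff K (A *ᴾ (T ++ F)) (e ⊕ M) ≈ coeff K A e * coeff K T M
  coeff-*ᴾ-leading N M T F []             e []            T≡M F-far = sym (zeroˡ _)
  coeff-*ᴾ-leading N M T F ((a , e′) ∷ A) e (e′<N ∷ A<N) T≡M F-far = begin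
    coeff K (mulMonomial a e′ (T ++ F) ++ A *ᴾ (T ++ F)) (e ⊕ M)
      ≈⟨ coeff-++ (mulMonomial a e′ (T ++ F)) _ _ ⟩
    coeff K (mulMonomial a e′ (T ++ F)) (e ⊕ M) + coeff K (A *ᴾ (T ++ F)) (e ⊕ M)
      ≈⟨ +-cong leading (coeff-*ᴾ-leading N M T F A e A<N T≡M F-far) ⟩
    termCoeff e′ e a * coeff K T M + coeff K A e * coeff K T M
      ≈⟨ distribʳ _ _ _ ⟨
    (termCoeff e′ e a + coeff K A e) * coeff K T M ∎
    where
    leading : coeff K (mulMonomial a e′ (T ++ F)) (e ⊕ M) ≈ termCoeff e′ e a * coeff K T M
    leading = begin
      coeff K (mulMonomial a e′ (T ++ F)) (e ⊕ M)
        ≡⟨ ≡.cong (λ q → coeff K q (e ⊕ M)) (mulMonomial-++ a e′ T F) ⟩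
      coeff K (mulMonomial a e′ T ++ mulMonomial a e′ F) (e ⊕ M)
        ≈⟨ coeff-++ (mulMonomial a e′ T) _ _ ⟩
      coeff K (mulMonomial a e′ T) (e ⊕ M) + coeff K (mulMonomial a e′ F) (e ⊕ M)
        ≈⟨ +-cong (coeff-mulMonomial-aligned a e′ e M T T≡M) (coeff-mulMonomial-far N a e′ e M F e′<N F-far) ⟩
      termCoeff e′ e a * coeff K T M + 0#
        ≈⟨ +-identityʳ _ ⟩
      termCoeff e′ e a * coeff K T M ∎

  *ᴾ-nonZero : ∀ {k} N (M : Vec ℕ k) T F A → ExponentsBelow N A → ExponentsEqual M T → FarBelow N M F →
               coeff K T M ≈ 1# → NonZeroPoly K A → NonZeroPoly K (A *ᴾ (T ++ F))
  *ᴾ-nonZero N M T F A A<N T≡M F-far T-leading (e , Aₑ≉0) = e ⊕ M , λ coeff≈0 → Aₑ≉0 (begin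
    coeff K A e                      ≈⟨ *-identityʳ _ ⟨
    coeff K A e * 1#                 ≈⟨ *-congˡ T-leading ⟨
    coeff K A e * coeff K T M        ≈⟨ coeff-*ᴾ-leading N M T F A e A<N T≡M F-far ⟨
    coeff K (A *ᴾ (T ++ F)) (e ⊕ M) ≈⟨ coeff≈0 ⟩
    0#                               ∎)

  FreeOf : ∀ {k} → Fin k → Carrier × Vec ℕ k → Set ℓ
  FreeOf j (a , e) = a ≈ 0# ⊎ lookup e j ≡ 0

  freeOf-mulMonomial : ∀ {k} (j : Fin k) a e q → FreeOf j (a , e) → All (FreeOf j) q → All (FreeOf j) (mulMonomial a e q)
  freeOf-mulMonomial j a e []            _    []              = []
  freeOf-mulMonomial j a e ((b , d) ∷ q) free (free′ ∷ frees) = product free free′ ∷ freeOf-mulMonomial j a e q free frees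
    where
    product : FreeOf j (a , e) → FreeOf j (b , d) → FreeOf j (a * b , e ⊕ d)
    product (inj₁ a≈0) _           = inj₁ (trans (*-congʳ a≈0) (zeroˡ b))
    product (inj₂ _)   (inj₁ b≈0)  = inj₁ (trans (*-congˡ b≈0) (zeroʳ a))
    product (inj₂ eⱼ≡0) (inj₂ dⱼ≡0) = inj₂ (≡.trans (Vec.lookup-zipWith ℕ._+_ j e d) (≡.cong₂ ℕ._+_ eⱼ≡0 dⱼ≡0))

  freeOf-*ᴾ : ∀ {k} (j : Fin k) p q → All (FreeOf j) p → All (FreeOf j) q → All (FreeOf j) (p *ᴾ q)
  freeOf-*ᴾ j []            q []            _     = []
  freeOf-*ᴾ j ((a , e) ∷ p) q (free ∷ frees) freeq =
    All.++⁺ (freeOf-mulMonomial j a e q free freeq) (freeOf-*ᴾ j p q frees freeq)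

  freeOf-^ᴾ : ∀ {k} (j : Fin k) p n → All (FreeOf j) p → All (FreeOf j) (p ^ᴾ n)
  freeOf-^ᴾ j p zero    _     = inj₂ (Vec.lookup∘tabulate _ j) ∷ []
  freeOf-^ᴾ j p (suc n) frees = freeOf-*ᴾ j p (p ^ᴾ n) frees (freeOf-^ᴾ j p n frees)

  coeff-tabulate-at : ∀ {k m} (M : Vec ℕ k) (f : Fin m → Carrier) →
                      coeff K (List.tabulate (λ j → (f j , M))) M ≈ sum f
  coeff-tabulate-at {m = zero}  M f = refl
  coeff-tabulate-at {m = suc m} M f = +-cong (termCoeff-refl M (f zero)) (coeff-tabulate-at M (λ j → f (suc j)))

  -- For u · z = c primitive, choose λ with Σ λⱼ uⱼⁿ = 1 (n = N + 1) and take
  --   W = Σⱼ λⱼ (uⱼⁿ zᴹ - zᴹ⁻ⁿᵉʲ (c - Σ_{t ≠ j} u_t z_t)ⁿ),   M = (n, …, n).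
  -- On the hyperplane the j-th summand is λⱼ zᴹ⁻ⁿᵉʲ ((uⱼ zⱼ)ⁿ - (uⱼ zⱼ)ⁿ) = 0. The first
  -- part has coefficient 1 at zᴹ, while every monomial of the second part has some
  -- exponent 0 where M has n; so multiplying by W cannot cancel the coefficient of a
  -- monomial of degree < n in each variable.
  module VanishingPolynomial {k} (h : PrimitiveHyperplane k) (N : ℕ) where
    open PrimitiveHyperplane h

    n : ℕ
    n = suc N

    λ′ : ℤ^ k
    λ′ = proj₁ (bezout-powers n coefficients normal isPrimitive)

    M : Vec ℕ k
    M = replicate k n

    solvedCoeff : Fin k → Fin k → Carrier
    solvedCoeff j t = if does (t ≟ j) then 0# else - fromℤ K (normal t)

    solvedFor : Fin k → Poly K k
    solvedFor j = (fromℤ K offset , tabulate (λ _ → 0)) ∷ List.tabulate (λ t → (solvedCoeff j t , unitExponent t 1))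

    leadingPart : Poly K k
    leadingPart = List.tabulate (λ j → (fromℤ K (λ′ j) * pow K (fromℤ K (normal j)) n , M))

    farSummand : Fin k → Poly K k
    farSummand j = mulMonomial (- fromℤ K (λ′ j)) (exponentExcept j n) (solvedFor j ^ᴾ n)

    farPart : Poly K k
    farPart = concat (List.tabulate farSummand)

    polynomial : Poly K k
    polynomial = leadingPart ++ farPart

    leadingPart-exponents : ExponentsEqual M leadingPart
    leadingPart-exponents = All.tabulate⁺ (λ _ → ≡.refl)

    leadingPart-coeff : coeff K leadingPart M ≈ 1#
    leadingPart-coeff = begin
      coeff K leadingPart M
        ≈⟨ coeff-tabulate-at M (λ j → fromℤ K (λ′ j) * pow K (fromℤ K (normal j)) n) ⟩
      sum (λ j → fromℤ K (λ′ j) * pow K (fromℤ K (normal j)) n)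
        ≈⟨ sum-cong-≋ (λ j → *-congˡ (fromℤ-^ (normal j) n)) ⟨
      sum (λ j → fromℤ K (λ′ j) * fromℤ K (normal j ℤ.^ n))
        ≈⟨ fromℤ-dot λ′ (λ j → normal j ℤ.^ n) ⟨
      fromℤ K (dot λ′ (λ j → normal j ℤ.^ n))
        ≡⟨ ≡.cong (fromℤ K) (proj₂ (bezout-powers n coefficients normal isPrimitive)) ⟩
      1# + 0#
        ≈⟨ +-identityʳ 1# ⟩
      1# ∎

    solvedFor-freeOf : ∀ j → All (FreeOf j) (solvedFor j)
    solvedFor-freeOf j = inj₂ (Vec.lookup∘tabulate _ j) ∷ All.tabulate⁺ unitTerm
      where
      unitTerm : ∀ t → FreeOf j (solvedCoeff j t , unitExponent t 1)
      unitTerm t with t ≟ j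
      ... | yes _   = inj₁ refl
      ... | no t≢j = inj₂ (≡.trans (Vec.lookup∘tabulate _ j)
                                   (≡.cong (λ b → if b then 1 else 0) (dec-false (j ≟ t) (t≢j ∘ ≡.sym))))

    farPart-far : FarBelow n M farPart
    farPart-far = All.concat⁺ (All.tabulate⁺ λ j → All.map (λ {t} → far j t)
      (freeOf-mulMonomial j _ _ _ (inj₂ (lookup-exponentExcept j n)) (freeOf-^ᴾ j (solvedFor j) n (solvedFor-freeOf j))))
      where
      far : ∀ j t → FreeOf j t → FarTerm n M t
      far j t (inj₁ a≈0)  = inj₁ a≈0
      far j t (inj₂ eⱼ≡0) =
        inj₂ (j , ≡.subst₂ ℕ._≤_ (≡.cong (ℕ._+ n) (≡.sym eⱼ≡0)) (≡.sym (Vec.lookup-replicate j n)) ℕ.≤-refl)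

    *-nonZero : ∀ A → ExponentsBelow n A → NonZeroPoly K A → NonZeroPoly K (A *ᴾ polynomial)
    *-nonZero A A<n = *ᴾ-nonZero n M leadingPart farPart A A<n leadingPart-exponents farPart-far leadingPart-coeff

    module _ (z : ℤ^ k) (z∈h : z ∈ᴴ h) where
      private
        X U : Fin k → Carrier
        X j = fromℤ K (z j)
        U j = fromℤ K (normal j)

      eval-solvedFor : ∀ j → eval K (solvedFor j) z ≈ U j * X j
      eval-solvedFor j = begin
        fromℤ K offset * evalMono K (tabulate (λ _ → 0)) z + eval K (List.tabulate linearTerm) z
          ≈⟨ +-cong (trans (*-congˡ (evalMono-zeros _ (λ _ → ≡.refl) z)) (*-identityʳ _)) (eval-tabulate linearTerm z) ⟩
        fromℤ K offset + sum (λ t → solvedCoeff j t * evalMono K (unitExponent t 1) z)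
          ≈⟨ +-congˡ (sum-cong-≋ term) ⟩
        fromℤ K offset + sum (λ t → if does (t ≟ j) then 0# else - (U t * X t))
          ≈⟨ +-congˡ (sum-except j (λ t → - (U t * X t))) ⟩
        fromℤ K offset + (sum (λ t → - (U t * X t)) - - (U j * X j))
          ≈⟨ +-congˡ (+-congʳ (trans (sum-neg (λ t → U t * X t)) (-‿cong U·X≈offset))) ⟩
        fromℤ K offset + (- fromℤ K offset - - (U j * X j))
          ≈⟨ solve 3 (λ c u x → c :+ (:- c :+ :- (:- (u :* x))) := u :* x) refl (fromℤ K offset) (U j) (X j) ⟩
        U j * X j ∎
        where
        linearTerm = λ t → (solvedCoeff j t , unitExponent t 1)
        U·X≈offset : sum (λ t → U t * X t) ≈ fromℤ K offset
        U·X≈offset = trans (sym (fromℤ-dot normal z)) (reflexive (≡.cong (fromℤ K) z∈h))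
        term : ∀ t → solvedCoeff j t * evalMono K (unitExponent t 1) z ≈ (if does (t ≟ j) then 0# else - (U t * X t))
        term t with t ≟ j
        ... | yes _ = zeroˡ _
        ... | no _  = trans (*-congˡ (trans (evalMono-unit t 1 z) (*-identityʳ _))) (sym (-‿distribˡ-* _ _))

      summand-vanishes : ∀ j → fromℤ K (λ′ j) * pow K (U j) n * evalMono K M z + eval K (farSummand j) z ≈ 0#
      summand-vanishes j = begin
        l * pow K (U j) n * evalMono K M z + eval K (farSummand j) z
          ≈⟨ +-cong (*-congˡ evalMono-M) (eval-mulMonomial (- l) (exponentExcept j n) (solvedFor j ^ᴾ n) z) ⟩
        l * pow K (U j) n * (b * pow K (X j) n) + - l * b * eval K (solvedFor j ^ᴾ n) z
          ≈⟨ +-congˡ (*-congˡ (trans (eval-^ᴾ (solvedFor j) n z) (trans (pow-cong n (eval-solvedFor j)) (pow-* (U j) (X j) n)))) ⟩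
        l * pow K (U j) n * (b * pow K (X j) n) + - l * b * (pow K (U j) n * pow K (X j) n)
          ≈⟨ solve 4 (λ l u b x → l :* u :* (b :* x) :+ :- l :* b :* (u :* x) := con ℤ.0ℤ) refl
                   l (pow K (U j) n) b (pow K (X j) n) ⟩
        0# ∎
        where
        l = fromℤ K (λ′ j)
        b = evalMono K (exponentExcept j n) z
        evalMono-M : evalMono K M z ≈ b * pow K (X j) n
        evalMono-M = trans (reflexive (≡.cong (λ e → evalMono K e z) (replicate≡exponentExcept⊕unit n j)))
                       (trans (evalMono-⊕ (exponentExcept j n) (unitExponent j n) z) (*-congˡ (evalMono-unit j n z)))

      vanishes : eval K polynomial z ≈ 0#
      vanishes = begin
        eval K (leadingPart ++ farPart) z
          ≈⟨ eval-++ leadingPart farPart z ⟩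
        eval K leadingPart z + eval K farPart z
          ≈⟨ +-cong (eval-tabulate (λ j → (fromℤ K (λ′ j) * pow K (U j) n , M)) z) (eval-concat-tabulate farSummand z) ⟩
        sum (λ j → fromℤ K (λ′ j) * pow K (U j) n * evalMono K M z) + sum (λ j → eval K (farSummand j) z)
          ≈⟨ ∑-distrib-+ (λ j → fromℤ K (λ′ j) * pow K (U j) n * evalMono K M z) (λ j → eval K (farSummand j) z) ⟨
        sum (λ j → fromℤ K (λ′ j) * pow K (U j) n * evalMono K M z + eval K (farSummand j) z)
          ≈⟨ sum-zero _ summand-vanishes ⟩
        0# ∎

  maxExponent : ∀ {k} → Poly K k → ℕ
  maxExponent []            = 0
  maxExponent ((_ , e) ∷ p) = maxEntry e ℕ.⊔ maxExponent p

  exponentsBelow : ∀ {k} (A : Poly K k) N → maxExponent A ℕ.≤ N → ExponentsBelow (suc N) A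
  exponentsBelow []            N _     = []
  exponentsBelow ((_ , e) ∷ A) N max≤N =
    (λ j → ℕ.s≤s (ℕ.≤-trans (lookup≤maxEntry e j) (ℕ.≤-trans (ℕ.m≤m⊔n _ _) max≤N)))
    ∷ exponentsBelow A N (ℕ.≤-trans (ℕ.m≤n⊔m (maxEntry e) _) max≤N)

  record CommonMultiples {k} (Hs : List (PrimitiveHyperplane k)) (A B : Poly K k) : Set (c ⊔ ℓ) where
    field
      A′ B′           : Poly K k
      factor          : ℤ^ k → Carrier
      A′-nonZero      : NonZeroPoly K A′
      B′-nonZero      : NonZeroPoly K B′
      eval-A′         : ∀ z → eval K A′ z ≈ eval K A z * factor z
      eval-B′         : ∀ z → eval K B′ z ≈ eval K B z * factor z
      factor-vanishes : ∀ z → Any (z ∈ᴴ_) Hs → factor z ≈ 0#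

  commonMultiples : ∀ {k} Hs (A B : Poly K k) → NonZeroPoly K A → NonZeroPoly K B → CommonMultiples Hs A B
  commonMultiples []       A B A≢0 B≢0 = record
    { A′ = A ; B′ = B ; factor = λ _ → 1# ; A′-nonZero = A≢0 ; B′-nonZero = B≢0
    ; eval-A′ = λ _ → sym (*-identityʳ _) ; eval-B′ = λ _ → sym (*-identityʳ _) ; factor-vanishes = λ _ () }
  commonMultiples (h ∷ Hs) A B A≢0 B≢0 = record
    { A′ = Rest.A′ ; B′ = Rest.B′ ; factor = factor ; A′-nonZero = Rest.A′-nonZero ; B′-nonZero = Rest.B′-nonZero
    ; eval-A′ = λ z → trans (Rest.eval-A′ z) (trans (*-congʳ (eval-*ᴾ A W.polynomial z)) (*-assoc _ _ _))
    ; eval-B′ = λ z → trans (Rest.eval-B′ z) (trans (*-congʳ (eval-*ᴾ B W.polynomial z)) (*-assoc _ _ _))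
    ; factor-vanishes = factor-vanishes }
    where
    N = maxExponent A ℕ.⊔ maxExponent B
    module W = VanishingPolynomial h N
    module Rest = CommonMultiples (commonMultiples Hs (A *ᴾ W.polynomial) (B *ᴾ W.polynomial)
      (W.*-nonZero A (exponentsBelow A N (ℕ.m≤m⊔n _ _)) A≢0)
      (W.*-nonZero B (exponentsBelow B N (ℕ.m≤n⊔m (maxExponent A) _)) B≢0))
    factor : ℤ^ _ → Carrier
    factor z = eval K W.polynomial z * Rest.factor z
    factor-vanishes : ∀ z → Any (z ∈ᴴ_) (h ∷ Hs) → factor z ≈ 0#
    factor-vanishes z (here z∈h)   = trans (*-congʳ (W.vanishes z z∈h)) (zeroˡ _)
    factor-vanishes z (there z∈Hs) = trans (*-congˡ (Rest.factor-vanishes z z∈Hs)) (zeroʳ _)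

  zero-middle : ∀ {a b c} → b ≈ 0# → a * b * c ≈ 0#
  zero-middle b≈0 = trans (*-congʳ (trans (*-congˡ b≈0) (zeroʳ _))) (zeroˡ _)

  extendByZero-recurrence : ∀ {k} (R : PolyhedralRegion k) (f : ℤ^ k → Carrier) i (A B : Poly K k) (w : ℤ^ k → Carrier) →
    (∀ z → z ∈R R → (z +e i) ∈R R → eval K A z * f z ≈ eval K B z * f (z +e i)) →
    (∀ z → Any (Crosses i z) R → w z ≈ 0#) →
    ∀ z → eval K A z * w z * extendByZero K R f z ≈ eval K B z * w z * extendByZero K R f (z +e i)
  extendByZero-recurrence R f i A B w rec w-vanishes z with z ∈R? R in in? | (z +e i) ∈R? R in in?′
  ... | true  | true  = begin
    eval K A z * w z * f z          ≈⟨ *-congʳ (*-comm _ _) ⟩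
    w z * eval K A z * f z          ≈⟨ *-assoc _ _ _ ⟩
    w z * (eval K A z * f z)        ≈⟨ *-congˡ (rec z (∈R?⇒∈R z R in?) (∈R?⇒∈R (z +e i) R in?′)) ⟩
    w z * (eval K B z * f (z +e i)) ≈⟨ *-assoc _ _ _ ⟨
    w z * eval K B z * f (z +e i)   ≈⟨ *-congʳ (*-comm _ _) ⟩
    eval K B z * w z * f (z +e i)   ∎
  ... | true  | false = trans (zero-middle (w-vanishes z (exit⇒crosses i z R in? in?′))) (sym (zeroʳ _))
  ... | false | true  = trans (zeroʳ _) (sym (zero-middle (w-vanishes z (entry⇒crosses i z R in? in?′))))
  ... | false | false = trans (zeroʳ _) (sym (zeroʳ _))

mainTheorem14 : ∀ {c ℓ : Level} (K : Field c ℓ) (k : ℕ) (R : PolyhedralRegion k)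
                (f : ℤ^ k → Field.Carrier K) →
                IsHypergeometricOn K R f →
                IsHypergeometric K (extendByZero K R f)
mainTheorem14 K k R f isHypergeometricOn i =
  let A , B , A≢0 , B≢0 , recurrence = isHypergeometricOn i
      open CommonMultiples (commonMultiples K (boundaryHyperplanes i R) A B A≢0 B≢0)
      g = extendByZero K R f
  in  A′ , B′ , A′-nonZero , B′-nonZero , λ z → begin
        eval K A′ z * g z                  ≈⟨ *-congʳ (eval-A′ z) ⟩
        eval K A z * factor z * g z        ≈⟨ extendByZero-recurrence K R f i A B factor recurrence
                                                (λ z → factor-vanishes z ∘ crosses⇒on-boundaryHyperplane i z R) z ⟩
        eval K B z * factor z * g (z +e i) ≈⟨ *-congʳ (eval-B′ z) ⟨
        eval K B′ z * g (z +e i)           ∎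
  where
  open Field K
  open import Relation.Binary.Reasoning.Setoid setoid
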